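{- For every partition $\lambda\in\mathcal P$ that is self-conjugate, $(\sigma\circ\pi)(\lambda)=\lambda$, and for all $\lambda\in\mathcal P$, $(\sigma\circ\pi)^2(\lambda)=\lambda$. Likewise, for $\phi\in\mathcal S$ such that $\sigma(\phi)$ is self-conjugate, $(\pi\circ\sigma)(\phi)=\phi$, and for all $\phi\in\mathcal S$, $(\pi\circ\sigma)^2(\phi)=\phi$.
   Context: $\mathcal P$ is the set of integer partitions (including the empty one). A partition $\phi=(\phi_1,\dots,\phi_r)$ is sequentially congruent if $\phi_i\equiv\phi_{i+1}\pmod i$ for $1\le i\le r-1$ and $\phi_r\equiv0\pmod r$; $\mathcal S$ is the set of such partitions. The map $\pi\colon\mathcal P\to\mathcal S$ sends $\lambda=(\lambda_1,\dots,\lambda_r)$ to $(\lambda'_1,\dots,\lambda'_r)$ with $\lambda'_i=i\lambda_i+\sum_{j=i+1}^r\lambda_j$. The map $\sigma\colon\mathcal S\to\mathcal P$ sends $\phi=(\phi_1,\dots,\phi_r)$ (with $\phi_k=0$ for $k>r$) to the partition in which each $i\ge1$ has multiplicity $(\phi_i-\phi_{i+1})/i$. A partition is self-conjugate if it equals its conjugate (the partition with transposed Ferrers–Young diagram). -}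

module Defs where

open import Data.Nat using (ℕ; zero; suc; _+_; _*_; _∸_; _≤_; _≥_; _≤?_)
open import Data.Nat.DivMod using (_/_; _%_)
open import Data.Nat.ListAction using (sum)
open import Data.Nat.Divisibility using (_∣_)
open import Data.List using (List; []; _∷_; _++_; replicate; map; filter; length; upTo)
open import Data.List.Relation.Unary.All using (All)
open import Data.List.Relation.Unary.Linked using (Linked)
open import Data.Product using (_×_)
open import Data.Unit using (⊤)
open import Relation.Binary.PropositionalEquality using (_≡_)

IsPartition : List ℕ → Set
IsPartition l = All (1 ≤_) l × Linked _≥_ l

-- SCfrom k (φ_{k+1}, …, φ_r) : the sequential-congruence conditions starting at index i = k+1:
-- φ_i ≡ φ_{i+1} (mod i) for consecutive entries, and i ∣ φ_i for the last entry (i = r).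
SCfrom : ℕ → List ℕ → Set
SCfrom k [] = ⊤
SCfrom k (x ∷ []) = suc k ∣ x
SCfrom k (x ∷ y ∷ r) = (x % suc k ≡ y % suc k) × SCfrom (suc k) (y ∷ r)

IsSeqCong : List ℕ → Set
IsSeqCong φ = IsPartition φ × SCfrom 0 φ

πFrom : ℕ → List ℕ → List ℕ
πFrom k [] = []
πFrom k (x ∷ r) = (suc k * x + sum r) ∷ πFrom (suc k) r

π : List ℕ → List ℕ
π = πFrom 0

head0 : List ℕ → ℕ
head0 [] = 0
head0 (x ∷ _) = x

-- σ : φ ↦ the partition in which i has multiplicity (φ_i − φ_{i+1}) / i  (φ_{r+1} = 0),
-- listed in weakly decreasing order.
σFrom : ℕ → List ℕ → List ℕ
σFrom k [] = []
σFrom k (x ∷ r) = σFrom (suc k) r ++ replicate ((x ∸ head0 r) / suc k) (suc k)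

σ : List ℕ → List ℕ
σ = σFrom 0

conj : List ℕ → List ℕ
conj l = map (λ j → length (filter (suc j ≤?_) l)) (upTo (head0 l))

SelfConjugate : List ℕ → Set
SelfConjugate l = conj l ≡ l

{-# OPTIONS --safe #-}
module Submission where

-- σ (π λ) is the conjugate of λ: the consecutive differences of π λ are
-- λ'_i − λ'_{i+1} = i (λ_i − λ_{i+1}), so σ (π λ) has λ_i − λ_{i+1} parts
-- equal to i, which is the column-length description of the conjugate.
-- Conjugation is an involution on partitions, and π maps 𝒫 onto 𝒮: from φ
-- one recovers λ_i = Σ_{j≥i} (φ_j − φ_{j+1}) / j, each quotient exact by
-- sequential congruence. Writing φ = π λ turns the statements about π ∘ σ
-- into the ones about σ ∘ π.

open import Defs
open import Data.Nat using (ℕ; zero; suc; _+_; _*_; _∸_; _≤_; _≥_; _<_; z≤n; s≤s; _≤?_; NonZero; >-nonZero)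
open import Data.Nat.Properties
open import Data.Nat.DivMod using (_/_; _%_; m≡m%n+[m/n]*n; m*n/n≡m; m/n*n≡m; m≥n⇒m/n>0)
open import Data.Nat.Divisibility using (_∣_; divides; ∣⇒≤)
open import Data.Nat.ListAction using (sum)
open import Data.List using (List; []; _∷_; _++_; replicate; map; filter; length; upTo; applyUpTo)
open import Data.List.Properties
  using (map-++; map-∘; map-cong; map-id; map-replicate; map-upTo; map-applyUpTo;
         length-map; length-++; length-replicate; filter-accept; filter-none)
open import Data.List.Relation.Unary.All using (All; []; _∷_)
import Data.List.Relation.Unary.All as All
open import Data.List.Relation.Unary.Linked using (Linked; []; [-]; _∷_)
open import Data.Product using (Σ; _×_; _,_)
open import Data.Unit using (⊤; tt)
open import Function using (_∘_)
open import Level using (Level)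
open import Relation.Binary.PropositionalEquality
open ≡-Reasoning

private
  variable
    a : Level
    A : Set a

applyUpTo-+ : ∀ (f : ℕ → A) m n →
              applyUpTo f (m + n) ≡ applyUpTo f m ++ applyUpTo (λ i → f (m + i)) n
applyUpTo-+ f zero    n = refl
applyUpTo-+ f (suc m) n = cong (f 0 ∷_) (applyUpTo-+ (f ∘ suc) m n)

applyUpTo-cong : ∀ (f g : ℕ → A) n → (∀ {i} → i < n → f i ≡ g i) →
                 applyUpTo f n ≡ applyUpTo g n
applyUpTo-cong f g zero    f≡g = refl
applyUpTo-cong f g (suc n) f≡g =
  cong₂ _∷_ (f≡g (s≤s z≤n)) (applyUpTo-cong (f ∘ suc) (g ∘ suc) n (f≡g ∘ s≤s))

applyUpTo-const : ∀ (c : A) n → applyUpTo (λ _ → c) n ≡ replicate n c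
applyUpTo-const c zero    = refl
applyUpTo-const c (suc n) = cong (c ∷_) (applyUpTo-const c n)

m%n≡o%n⇒n∣m∸o : ∀ m n o .{{_ : NonZero n}} → m % n ≡ o % n → n ∣ m ∸ o
m%n≡o%n⇒n∣m∸o m n o eq = divides (m / n ∸ o / n) (begin
  m ∸ o                                   ≡⟨ cong₂ _∸_ (m≡m%n+[m/n]*n m n) (m≡m%n+[m/n]*n o n) ⟩
  (m % n + m / n * n) ∸ (o % n + o / n * n) ≡⟨ cong (λ r → (r + m / n * n) ∸ (o % n + o / n * n)) eq ⟩
  (o % n + m / n * n) ∸ (o % n + o / n * n) ≡⟨ [m+n]∸[m+o]≡n∸o (o % n) _ _ ⟩
  m / n * n ∸ o / n * n                   ≡⟨ *-distribʳ-∸ n (m / n) (o / n) ⟨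
  (m / n ∸ o / n) * n                     ∎)

[n*x+s∸n*y+s]/n≡x∸y : ∀ n .{{_ : NonZero n}} x y s → ((n * x + s) ∸ (n * y + s)) / n ≡ x ∸ y
[n*x+s∸n*y+s]/n≡x∸y n x y s = begin
  ((n * x + s) ∸ (n * y + s)) / n ≡⟨ cong₂ (λ u v → (u ∸ v) / n) (+-comm (n * x) s) (+-comm (n * y) s) ⟩
  ((s + n * x) ∸ (s + n * y)) / n ≡⟨ cong (_/ n) ([m+n]∸[m+o]≡n∸o s (n * x) (n * y)) ⟩
  (n * x ∸ n * y) / n             ≡⟨ cong (_/ n) (*-distribˡ-∸ n x y) ⟨
  (n * (x ∸ y)) / n               ≡⟨ cong (_/ n) (*-comm n (x ∸ y)) ⟩
  ((x ∸ y) * n) / n               ≡⟨ m*n/n≡m (x ∸ y) n ⟩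
  x ∸ y                           ∎

Decreasing : List ℕ → Set
Decreasing []      = ⊤
Decreasing (x ∷ r) = head0 r ≤ x × Decreasing r

Linked⇒Decreasing : ∀ {l} → Linked _≥_ l → Decreasing l
Linked⇒Decreasing []      = tt
Linked⇒Decreasing [-]     = z≤n , tt
Linked⇒Decreasing (p ∷ q) = p , Linked⇒Decreasing q

All≤head0 : ∀ {l} → Decreasing l → All (_≤ head0 l) l
All≤head0 {[]}    _       = []
All≤head0 {x ∷ r} (p , d) = ≤-refl ∷ All.map (λ y≤ → ≤-trans y≤ p) (All≤head0 d)

-- Conjugation row by row: the first row x adds a cell to each of the
-- head0 r columns of r and contributes x ∸ head0 r new columns of height 1.
conj′ : List ℕ → List ℕ
conj′ []      = []
conj′ (x ∷ r) = map suc (conj′ r) ++ replicate (x ∸ head0 r) 1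

head0-πFrom : ∀ k μ → head0 (πFrom (suc k) μ) ≡ suc k * head0 μ + sum μ
head0-πFrom k []      = sym (trans (+-identityʳ _) (*-zeroʳ (suc k)))
head0-πFrom k (m ∷ s) = begin
  (m + suc k * m) + sum s ≡⟨ cong (_+ sum s) (+-comm m (suc k * m)) ⟩
  (suc k * m + m) + sum s ≡⟨ +-assoc (suc k * m) m (sum s) ⟩
  suc k * m + (m + sum s) ∎

σFrom-πFrom : ∀ k l → σFrom k (πFrom k l) ≡ map (k +_) (conj′ l)
σFrom-πFrom k []      = refl
σFrom-πFrom k (x ∷ r) = begin
  σFrom (suc k) (πFrom (suc k) r) ++ replicate (gap / suc k) (suc k)
    ≡⟨ cong₂ (λ c m → c ++ replicate m (suc k)) (σFrom-πFrom (suc k) r) multiplicity ⟩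
  map (suc k +_) (conj′ r) ++ replicate (x ∸ head0 r) (suc k)
    ≡⟨ cong₂ _++_ (trans (map-cong (λ n → sym (+-suc k n)) (conj′ r)) (map-∘ (conj′ r)))
                  (trans (cong (replicate (x ∸ head0 r)) (+-comm 1 k)) (sym (map-replicate (k +_) _ 1))) ⟩
  map (k +_) (map suc (conj′ r)) ++ map (k +_) (replicate (x ∸ head0 r) 1)
    ≡⟨ map-++ (k +_) (map suc (conj′ r)) _ ⟨
  map (k +_) (conj′ (x ∷ r)) ∎
  where
  gap : ℕ
  gap = (suc k * x + sum r) ∸ head0 (πFrom (suc k) r)
  multiplicity : gap / suc k ≡ x ∸ head0 r
  multiplicity = begin
    gap / suc k
      ≡⟨ cong (λ h → ((suc k * x + sum r) ∸ h) / suc k) (head0-πFrom k r) ⟩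
    ((suc k * x + sum r) ∸ (suc k * head0 r + sum r)) / suc k
      ≡⟨ [n*x+s∸n*y+s]/n≡x∸y (suc k) x (head0 r) (sum r) ⟩
    x ∸ head0 r
      ∎

σ∘π≡conj′ : ∀ l → σ (π l) ≡ conj′ l
σ∘π≡conj′ l = trans (σFrom-πFrom 0 l) (map-id (conj′ l))

count> : ℕ → List ℕ → ℕ
count> j l = length (filter (suc j ≤?_) l)

count>-∷ : ∀ {j x} r → j < x → count> j (x ∷ r) ≡ suc (count> j r)
count>-∷ r j<x = cong length (filter-accept (suc _ ≤?_) j<x)

count>-head0 : ∀ {j r} → Decreasing r → head0 r ≤ j → count> j r ≡ 0
count>-head0 d h≤j =
  cong length (filter-none (suc _ ≤?_) (All.map (λ y≤h j<y → <⇒≱ j<y (≤-trans y≤h h≤j)) (All≤head0 d)))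

conj≡conj′ : ∀ {l} → Decreasing l → conj l ≡ conj′ l
conj≡conj′ {[]}    _       = refl
conj≡conj′ {x ∷ r} (p , d) = begin
  map F (upTo x)                                   ≡⟨ map-upTo F x ⟩
  applyUpTo F x                                    ≡⟨ cong (applyUpTo F) (m+[n∸m]≡n p) ⟨
  applyUpTo F (h + (x ∸ h))                        ≡⟨ applyUpTo-+ F h (x ∸ h) ⟩
  applyUpTo F h ++ applyUpTo (λ i → F (h + i)) (x ∸ h)
    ≡⟨ cong₂ _++_ (applyUpTo-cong F (suc ∘ G) h (λ i<h → count>-∷ r (<-≤-trans i<h p)))
                  (trans (applyUpTo-cong (λ i → F (h + i)) (λ _ → 1) (x ∸ h) new-column)
                         (applyUpTo-const 1 (x ∸ h))) ⟩
  applyUpTo (suc ∘ G) h ++ replicate (x ∸ h) 1     ≡⟨ cong (_++ replicate (x ∸ h) 1) (map-applyUpTo G suc h) ⟨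
  map suc (applyUpTo G h) ++ replicate (x ∸ h) 1
    ≡⟨ cong (λ c → map suc c ++ replicate (x ∸ h) 1) (trans (sym (map-upTo G h)) (conj≡conj′ d)) ⟩
  conj′ (x ∷ r)                                    ∎
  where
  h : ℕ
  h = head0 r
  F G : ℕ → ℕ
  F j = count> j (x ∷ r)
  G j = count> j r
  new-column : ∀ {i} → i < x ∸ h → F (h + i) ≡ 1
  new-column {i} i<x∸h = begin
    F (h + i)          ≡⟨ count>-∷ r (subst (h + i <_) (m+[n∸m]≡n p) (+-monoʳ-< h i<x∸h)) ⟩
    suc (G (h + i))    ≡⟨ cong suc (count>-head0 d (m≤m+n h i)) ⟩
    1                  ∎

conj′-replicate-1 : ∀ d → conj′ (replicate (suc d) 1) ≡ suc d ∷ []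
conj′-replicate-1 zero    = refl
conj′-replicate-1 (suc d) rewrite conj′-replicate-1 d = refl

conj′-map-suc-++ : ∀ c d → 0 < length c + d →
                   conj′ (map suc c ++ replicate d 1) ≡ (length c + d) ∷ conj′ c
conj′-map-suc-++ []          (suc d) _ = conj′-replicate-1 d
conj′-map-suc-++ (m ∷ [])    zero    _ = refl
conj′-map-suc-++ (m ∷ [])    (suc d) _ rewrite conj′-replicate-1 d = refl
conj′-map-suc-++ (m ∷ n ∷ c) d       _ rewrite conj′-map-suc-++ (n ∷ c) d (s≤s z≤n) = refl

length-conj′ : ∀ {l} → Decreasing l → length (conj′ l) ≡ head0 l
length-conj′ {[]}    _       = refl
length-conj′ {x ∷ r} (p , d) = begin
  length (map suc (conj′ r) ++ replicate (x ∸ head0 r) 1)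
    ≡⟨ length-++ (map suc (conj′ r)) ⟩
  length (map suc (conj′ r)) + length (replicate (x ∸ head0 r) 1)
    ≡⟨ cong₂ _+_ (trans (length-map suc (conj′ r)) (length-conj′ d)) (length-replicate (x ∸ head0 r)) ⟩
  head0 r + (x ∸ head0 r)
    ≡⟨ m+[n∸m]≡n p ⟩
  x ∎

conj′-involutive : ∀ {l} → All (1 ≤_) l → Decreasing l → conj′ (conj′ l) ≡ l
conj′-involutive {[]}    _          _       = refl
conj′-involutive {x ∷ r} (1≤x ∷ pr) (p , d) = begin
  conj′ (map suc (conj′ r) ++ replicate (x ∸ head0 r) 1)
    ≡⟨ conj′-map-suc-++ (conj′ r) (x ∸ head0 r) (subst (0 <_) (sym first-row) 1≤x) ⟩
  (length (conj′ r) + (x ∸ head0 r)) ∷ conj′ (conj′ r)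
    ≡⟨ cong₂ _∷_ first-row (conj′-involutive pr d) ⟩
  x ∷ r
    ∎
  where
  first-row : length (conj′ r) + (x ∸ head0 r) ≡ x
  first-row = trans (cong (_+ (x ∸ head0 r)) (length-conj′ d)) (m+[n∸m]≡n p)

head0-replicate-1 : ∀ d → head0 (replicate d 1) ≤ 1
head0-replicate-1 zero    = z≤n
head0-replicate-1 (suc d) = ≤-refl

replicate-1-decreasing : ∀ d → Decreasing (replicate d 1)
replicate-1-decreasing zero    = tt
replicate-1-decreasing (suc d) = head0-replicate-1 d , replicate-1-decreasing d

map-suc-++-decreasing : ∀ {c} d → Decreasing c → Decreasing (map suc c ++ replicate d 1)
map-suc-++-decreasing {[]}        d _       = replicate-1-decreasing d
map-suc-++-decreasing {m ∷ []}    d _       = ≤-trans (head0-replicate-1 d) (s≤s z≤n) , replicate-1-decreasing d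
map-suc-++-decreasing {m ∷ n ∷ c} d (p , q) = s≤s p , map-suc-++-decreasing d q

conj′-decreasing : ∀ l → Decreasing (conj′ l)
conj′-decreasing []      = tt
conj′-decreasing (x ∷ r) = map-suc-++-decreasing _ (conj′-decreasing r)

SCfrom-tail : ∀ {k x} r → SCfrom k (x ∷ r) → SCfrom (suc k) r
SCfrom-tail []      _       = tt
SCfrom-tail (y ∷ r) (_ , s) = s

SCfrom⇒∣∸head0 : ∀ {k x} r → SCfrom k (x ∷ r) → suc k ∣ x ∸ head0 r
SCfrom⇒∣∸head0     []      s       = s
SCfrom⇒∣∸head0 {k} (y ∷ r) (e , _) = m%n≡o%n⇒n∣m∸o _ (suc k) y e

πInvFrom : ℕ → List ℕ → List ℕ
πInvFrom k []      = []
πInvFrom k (x ∷ r) = ((x ∸ head0 r) / suc k + head0 (πInvFrom (suc k) r)) ∷ πInvFrom (suc k) r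

πFrom-πInvFrom : ∀ k {φ} → Decreasing φ → SCfrom k φ → πFrom k (πInvFrom k φ) ≡ φ
πFrom-πInvFrom k {[]}    _         _ = refl
πFrom-πInvFrom k {x ∷ r} (h≤x , d) s = cong₂ _∷_ first tail-eq
  where
  μ : List ℕ
  μ = πInvFrom (suc k) r
  q : ℕ
  q = (x ∸ head0 r) / suc k
  tail-eq : πFrom (suc k) μ ≡ r
  tail-eq = πFrom-πInvFrom (suc k) d (SCfrom-tail r s)
  first : suc k * (q + head0 μ) + sum μ ≡ x
  first = begin
    suc k * (q + head0 μ) + sum μ         ≡⟨ cong (_+ sum μ) (*-distribˡ-+ (suc k) q (head0 μ)) ⟩
    (suc k * q + suc k * head0 μ) + sum μ ≡⟨ +-assoc (suc k * q) _ (sum μ) ⟩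
    suc k * q + (suc k * head0 μ + sum μ) ≡⟨ cong₂ _+_ (trans (*-comm (suc k) q) (m/n*n≡m (SCfrom⇒∣∸head0 r s)))
                                                       (trans (sym (head0-πFrom k μ)) (cong head0 tail-eq)) ⟩
    (x ∸ head0 r) + head0 r               ≡⟨ m∸n+n≡m h≤x ⟩
    x                                     ∎

πInvFrom-decreasing : ∀ k φ → Decreasing (πInvFrom k φ)
πInvFrom-decreasing k []      = tt
πInvFrom-decreasing k (x ∷ r) = m≤n+m _ _ , πInvFrom-decreasing (suc k) r

πInvFrom-positive : ∀ k {φ} → All (1 ≤_) φ → SCfrom k φ → All (1 ≤_) (πInvFrom k φ)
πInvFrom-positive k []                      _ = []
πInvFrom-positive k {x ∷ []}    (1≤x ∷ _)   s =
  ≤-trans (m≥n⇒m/n>0 (∣⇒≤ ⦃ >-nonZero 1≤x ⦄ s)) (m≤m+n _ 0) ∷ []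
πInvFrom-positive k {x ∷ y ∷ r} (_ ∷ 1≤y∷r) s
  with πInvFrom-positive (suc k) 1≤y∷r (SCfrom-tail {x = x} (y ∷ r) s)
... | 1≤head ∷ rest = ≤-trans 1≤head (m≤n+m _ ((x ∸ y) / suc k)) ∷ 1≤head ∷ rest

π-onto : ∀ {φ} → IsSeqCong φ → Σ (List ℕ) λ μ → (All (1 ≤_) μ × Decreasing μ) × π μ ≡ φ
π-onto {φ} ((pos , linked) , s) =
  πInvFrom 0 φ , (πInvFrom-positive 0 pos s , πInvFrom-decreasing 0 φ) , πFrom-πInvFrom 0 (Linked⇒Decreasing linked) s

σ∘π-involutive : ∀ {l} → All (1 ≤_) l → Decreasing l → σ (π (σ (π l))) ≡ l
σ∘π-involutive {l} pos d = begin
  σ (π (σ (π l))) ≡⟨ σ∘π≡conj′ (σ (π l)) ⟩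
  conj′ (σ (π l)) ≡⟨ cong conj′ (σ∘π≡conj′ l) ⟩
  conj′ (conj′ l) ≡⟨ conj′-involutive pos d ⟩
  l               ∎

corollary3p2 :
    ((l : List ℕ) → IsPartition l → SelfConjugate l → σ (π l) ≡ l)
    × ((l : List ℕ) → IsPartition l → σ (π (σ (π l))) ≡ l)
    × ((φ : List ℕ) → IsSeqCong φ → SelfConjugate (σ φ) → π (σ φ) ≡ φ)
    × ((φ : List ℕ) → IsSeqCong φ → π (σ (π (σ φ))) ≡ φ)
corollary3p2 = σ∘π-fix , σ∘π-involution , π∘σ-fix , π∘σ-involution
  where
  σ∘π-fix : (l : List ℕ) → IsPartition l → SelfConjugate l → σ (π l) ≡ l
  σ∘π-fix l (_ , linked) sc = trans (σ∘π≡conj′ l) (trans (sym (conj≡conj′ (Linked⇒Decreasing linked))) sc)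

  σ∘π-involution : (l : List ℕ) → IsPartition l → σ (π (σ (π l))) ≡ l
  σ∘π-involution l (pos , linked) = σ∘π-involutive pos (Linked⇒Decreasing linked)

  π∘σ-fix : (φ : List ℕ) → IsSeqCong φ → SelfConjugate (σ φ) → π (σ φ) ≡ φ
  π∘σ-fix φ sq sc with π-onto sq
  ... | μ , (pos , d) , refl = cong π (begin
    σ (π μ)          ≡⟨ sc ⟨
    conj (σ (π μ))   ≡⟨ cong conj (σ∘π≡conj′ μ) ⟩
    conj (conj′ μ)   ≡⟨ conj≡conj′ (conj′-decreasing μ) ⟩
    conj′ (conj′ μ)  ≡⟨ conj′-involutive pos d ⟩
    μ                ∎)

  π∘σ-involution : (φ : List ℕ) → IsSeqCong φ → π (σ (π (σ φ))) ≡ φ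
  π∘σ-involution φ sq with π-onto sq
  ... | μ , (pos , d) , refl = cong π (σ∘π-involutive pos d)
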